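{- Let $k\ge 1$ and $n>1$ be integers, and define $A_k(m)=(-1)^m\sum_{j=1}^{m-1}(-1)^{j+1}j^k$ for integers $m\ge 1$. Then the ratio $A_k(n+1)/A_k(n)$ is an integer if and only if at least one of the following conditions holds: (a) $n=2$; (b) $k=1$ and $n$ is even; (c) $k\in\{1,2\}$ and $n=3$.
   Context: Equivalently, $A_k(m)=(m-1)^k-(m-2)^k+(m-3)^k-\dots+(-1)^{m}\cdot 1^k$, which is positive for $m>1$, and $A_k(n+1)/A_k(n)$ equals $-(1^k-2^k+\dots+(-1)^{n+1}n^k)/(1^k-2^k+\dots+(-1)^n(n-1)^k)$. -}

module Defs where

open import Data.Nat using (ℕ; zero; suc; _∸_)
open import Data.Integer using (ℤ; +_; -_; _+_; _*_; _^_)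

sgn : ℕ → ℤ
sgn m = (- (+ 1)) ^ m

S : ℕ → ℕ → ℤ
S k zero    = + 0
S k (suc j) = S k j + sgn (suc (suc j)) * (+ suc j) ^ k

A : ℕ → ℕ → ℤ
A k m = sgn m * S k (m ∸ 1)

module Submission where

-- A k n = (-1)^n Σ_{j<n} (-1)^(j+1) j^k is a natural number a k n with
-- a k n + a k (n+1) = n^k, so A k n ∣ A k (n+1) iff a k n ∣ n^k.  The
-- listed cases are checked directly; every other case (k ≥ 1, n ≥ 2) has
-- an obstruction to a k n ∣ n^k:
--   * n = 2d + 1, d > 1 odd: d ∣ a k n, and d is coprime to n;
--   * n ≡ 1 (mod 4), n > 1: a k n is even, and n is odd;
--   * n = 3, k ≥ 3: a k 3 = 2^k - 1 ≡ 7 (mod 8) divides no power of 3;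
--   * n ≥ 4 even, k even: n - 1 ∣ a k n, and n - 1 is coprime to n;
--   * n = 2c ≥ 4, k ≥ 3 odd: a k n ≡ k c² (mod 2c²) forces a k n ≤ c^k,
--     contradicting (n - 1)^k < 2 a k n.
-- The congruences come from pairing terms of the alternating sum (mirror
-- and shift lemmas), the inequality from convexity of x ↦ x^k.

module Arithmetic where
  open import Data.Nat
  open import Data.Nat.Properties
  open import Data.Nat.Divisibility
  open import Data.Nat.Coprimality as Coprimality using (Coprime; coprime-divisor)
  open import Data.Nat.Tactic.RingSolver using (solve-∀)
  open import Data.Product using (_,_)
  open import Relation.Nullary using (¬_)
  open import Relation.Binary.PropositionalEquality

  data Parity : ℕ → Set where
    even : ∀ h → Parity (h + h)
    odd  : ∀ h → Parity (suc (h + h))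

  even-or-odd : ∀ n → Parity n
  even-or-odd zero    = even 0
  even-or-odd (suc n) with even-or-odd n
  ... | even h = odd h
  ... | odd h  = subst Parity (cong suc (+-suc h h)) (even (suc h))

  2∣h+h : ∀ h → 2 ∣ h + h
  2∣h+h h = divides h (double h)
    where
    double : ∀ h → h + h ≡ h * 2
    double = solve-∀

  coprime-suc-multiple : ∀ {d m} → d ∣ m → Coprime d (suc m)
  coprime-suc-multiple {d} {m} d∣m {e} (e∣d , e∣m+1) =
    ∣1⇒≡1 (∣m+n∣m⇒∣n (subst (e ∣_) (+-comm 1 m) e∣m+1) (∣-trans e∣d d∣m))

  odd-coprime-2 : ∀ h → Coprime (suc (h + h)) 2
  odd-coprime-2 h = Coprimality.sym (coprime-suc-multiple (2∣h+h h))

  odd-not-even : ∀ h → ¬ 2 ∣ suc (h + h)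
  odd-not-even h 2∣odd with odd-coprime-2 h (2∣odd , ∣-refl)
  ... | ()

  coprime-pow-divisor : ∀ {d m} k x → Coprime d m → d ∣ m ^ k * x → d ∣ x
  coprime-pow-divisor {d}     zero    x coprime d∣x     = subst (d ∣_) (+-identityʳ x) d∣x
  coprime-pow-divisor {d} {m} (suc k) x coprime d∣mᵏ⁺¹x =
    coprime-pow-divisor k x coprime (coprime-divisor coprime (subst (d ∣_) (*-assoc m (m ^ k) x) d∣mᵏ⁺¹x))

  coprime-pow : ∀ {d m} k → Coprime d m → d ∣ m ^ k → d ≡ 1
  coprime-pow {d} {m} k coprime d∣mᵏ =
    ∣1⇒≡1 (coprime-pow-divisor k 1 coprime (subst (d ∣_) (sym (*-identityʳ (m ^ k))) d∣mᵏ))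

  pow-* : ∀ x y k → (x * y) ^ k ≡ x ^ k * y ^ k
  pow-* x y zero    = refl
  pow-* x y (suc k) = trans (cong (x * y *_) (pow-* x y k)) (regroup x y (x ^ k) (y ^ k))
    where
    regroup : ∀ x y P Q → x * y * (P * Q) ≡ (x * P) * (y * Q)
    regroup = solve-∀

module Congruences where
  open import Data.Nat as ℕ using (ℕ; zero; suc) renaming (_+_ to _+ℕ_)
  import Data.Nat.Divisibility as ℕ
  open import Data.Nat.Coprimality using (coprime-divisor)
  open import Data.Integer using (ℤ; +_; -_; _+_; _*_; _-_; _^_; 0ℤ; 1ℤ; -1ℤ)
  import Data.Integer.Properties as ℤ
  open import Data.Integer.Divisibility.Signed
  open import Data.Integer.Tactic.RingSolver using (solve-∀)
  open import Relation.Binary.PropositionalEquality using (_≡_; refl; sym; trans; cong; subst)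
  open import Defs using (sgn)
  open Arithmetic using (odd-coprime-2)

  -- The identity is used only inside
  -- the equality field, so the result is a constructor without normalising
  -- the identity's proof.
  ∣-≡ : ∀ {d x y} → d ∣ x → x ≡ y → d ∣ y
  ∣-≡ (divides q x≡qd) x≡y = divides q (trans (sym x≡y) x≡qd)

  ≡-∣ : ∀ {d d' x} → d ≡ d' → d ∣ x → d' ∣ x
  ≡-∣ d≡d' (divides q x≡qd) = divides q (trans x≡qd (cong (q *_) d≡d'))

  ∣-zero : ∀ d → d ∣ 0ℤ
  ∣-zero d = divides 0ℤ refl

  infix 4 _≡_mod_
  _≡_mod_ : ℤ → ℤ → ℤ → Set
  x ≡ y mod m = m ∣ x - y

  sgn-+ : ∀ m n → sgn (m +ℕ n) ≡ sgn m * sgn n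
  sgn-+ = ℤ.^-distribˡ-+-* -1ℤ

  sgn-sq : ∀ m → sgn m * sgn m ≡ 1ℤ
  sgn-sq zero    = refl
  sgn-sq (suc m) = trans (flip-signs (sgn m)) (sgn-sq m)
    where
    flip-signs : ∀ s → (-1ℤ * s) * (-1ℤ * s) ≡ s * s
    flip-signs = solve-∀

  sgn-even : ∀ h → sgn (h +ℕ h) ≡ 1ℤ
  sgn-even h = trans (sgn-+ h h) (sgn-sq h)

  sgn-odd : ∀ h → sgn (suc (h +ℕ h)) ≡ -1ℤ
  sgn-odd h = cong (-1ℤ *_) (sgn-even h)

  neg-pow : ∀ x e → (- x) ^ e ≡ sgn e * x ^ e
  neg-pow x zero    = refl
  neg-pow x (suc e) = trans (cong (- x *_) (neg-pow x e)) (regroup x (sgn e) (x ^ e))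
    where
    regroup : ∀ a s p → (- a) * (s * p) ≡ (-1ℤ * s) * (a * p)
    regroup = solve-∀

  neg-pow-even : ∀ x e → sgn e ≡ 1ℤ → (- x) ^ e ≡ x ^ e
  neg-pow-even x e e-even =
    trans (neg-pow x e) (trans (cong (_* x ^ e) e-even) (ℤ.*-identityˡ (x ^ e)))

  pos-pow : ∀ x e → (+ x) ^ e ≡ + (x ℕ.^ e)
  pos-pow x zero    = refl
  pos-pow x (suc e) = trans (cong (+ x *_) (pos-pow x e)) (sym (ℤ.pos-* x (x ℕ.^ e)))

  pow-cong : ∀ x y e → (y + x) ^ e ≡ y ^ e mod x
  pow-cong x y zero    = ∣-zero x
  pow-cong x y (suc e) =
    ∣-≡ (∣m∣n⇒∣m+n (∣m⇒∣m*n ((y + x) ^ e) ∣-refl) (∣n⇒∣m*n y (pow-cong x y e)))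
        (expand x y ((y + x) ^ e) (y ^ e))
    where
    expand : ∀ a b P Y → a * P + b * (P - Y) ≡ (b + a) * P - b * Y
    expand = solve-∀

  -- The binomial theorem to first order:
  -- (y + x)^(e+1) ≡ y^(e+1) + (e+1) x y^e (mod x²).
  pow-cong-sq : ∀ x y e → (y + x) ^ suc e ≡ y ^ suc e + + suc e * x * y ^ e mod x * x
  pow-cong-sq x y zero    = ∣-≡ (∣-zero (x * x)) (sym (linear x y))
    where
    linear : ∀ a b → (b + a) * 1ℤ - (b * 1ℤ + 1ℤ * a * 1ℤ) ≡ 0ℤ
    linear = solve-∀
  pow-cong-sq x y (suc e) =
    ∣-≡ (∣m∣n⇒∣m+n (∣n⇒∣m*n (y + x) (pow-cong-sq x y e)) (∣m⇒∣m*n (+ suc e * y ^ e) ∣-refl))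
        (expand y x ((y + x) ^ suc e) (y ^ e) (+ suc e))
    where
    expand : ∀ b a P Y c → (b + a) * (P - (b * Y + c * a * Y)) + (a * a) * (c * Y)
                         ≡ (b + a) * P - (b * (b * Y) + (1ℤ + c) * a * (b * Y))
    expand = solve-∀

  odd-cancel-2 : ∀ h X → + suc (h +ℕ h) ∣ + 2 * X → + suc (h +ℕ h) ∣ X
  odd-cancel-2 h X d∣2X =
    ∣ᵤ⇒∣ (coprime-divisor (odd-coprime-2 h) (subst (suc (h +ℕ h) ℕ.∣_) (ℤ.abs-* (+ 2) X) (∣⇒∣ᵤ d∣2X)))

module AlternatingSums where
  open import Data.Nat using (ℕ; zero; suc) renaming (_+_ to _+ℕ_)
  import Data.Nat.Properties as ℕ
  open import Data.Nat.Tactic.RingSolver renaming (solve-∀ to solveℕ-∀)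
  open import Data.Integer using (ℤ; +_; -_; _+_; _*_; _-_; _^_; 0ℤ; 1ℤ; -1ℤ)
  import Data.Integer.Properties as ℤ
  open import Data.Integer.Divisibility.Signed
  open import Data.Integer.Tactic.RingSolver using (solve-∀)
  open import Relation.Binary.PropositionalEquality using (_≡_; refl; sym; trans; cong; cong₂; module ≡-Reasoning)
  open ≡-Reasoning
  open import Defs using (sgn; S)
  open Congruences

  Σ : (ℕ → ℤ) → ℕ → ℤ
  Σ f zero    = 0ℤ
  Σ f (suc N) = Σ f N + f (suc N)

  -- Pairing the first N terms of f 1 + ... + f D
  -- with the last N ones (N + M = D) gives Σ f N + Σ f D ≡ Σ f M + w Σ g N;
  -- for N = D this reads 2 Σ f D ≡ w Σ g D.
  mirror : ∀ μ w (f g : ℕ → ℤ) D →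
           (∀ j j' → j +ℕ j' ≡ suc D → f j + f j' ≡ w * g j mod μ) →
           ∀ N M → N +ℕ M ≡ D → Σ f N + Σ f D ≡ Σ f M + w * Σ g N mod μ
  mirror μ w f g D pair zero M refl = ∣-≡ (∣-zero μ) (sym (cancel (Σ f M) w))
    where
    cancel : ∀ X w → 0ℤ + X - (X + w * 0ℤ) ≡ 0ℤ
    cancel = solve-∀
  mirror μ w f g D pair (suc N) M N+1+M≡D =
    ∣-≡ (∣m∣n⇒∣m+n (mirror μ w f g D pair N (suc M) N+[M+1]≡D)
                   (pair (suc N) (suc M) (cong suc N+[M+1]≡D)))
        (regroup (Σ f N) (Σ f D) (Σ f M) (Σ g N) (f (suc N)) (f (suc M)) (g (suc N)) w)
    where
    N+[M+1]≡D : N +ℕ suc M ≡ D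
    N+[M+1]≡D = trans (ℕ.+-suc N M) N+1+M≡D
    regroup : ∀ FN FD FM GN a b c w →
              (FN + FD - ((FM + b) + w * GN)) + (a + b - w * c)
              ≡ (FN + a) + FD - (FM + w * (GN + c))
    regroup = solve-∀

  antiperiodic : ∀ μ (f : ℕ → ℤ) d → (∀ j → μ ∣ f (j +ℕ d) + f j) → μ ∣ Σ f (d +ℕ d)
  antiperiodic μ f d anti = ∣-≡ (shifted d) (cancel (Σ f (d +ℕ d)) (Σ f d))
    where
    -- Σ f (N + d) ≡ Σ f d - Σ f N: the window (N, N + d] sums to zero.
    shifted : ∀ N → Σ f (N +ℕ d) ≡ Σ f d - Σ f N mod μ
    shifted zero    = ∣-≡ (∣-zero μ) (sym (cancel₀ (Σ f d)))
      where
      cancel₀ : ∀ X → X - (X - 0ℤ) ≡ 0ℤ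
      cancel₀ = solve-∀
    shifted (suc N) =
      ∣-≡ (∣m∣n⇒∣m+n (shifted N) (anti (suc N)))
          (regroup (Σ f (N +ℕ d)) (Σ f d) (Σ f N) (f (suc N +ℕ d)) (f (suc N)))
      where
      regroup : ∀ A B C a b → (A - (B - C)) + (a + b) ≡ (A + a) - (B - (C + b))
      regroup = solve-∀
    cancel : ∀ X Y → X - (Y - Y) ≡ X
    cancel = solve-∀

  t : ℕ → ℕ → ℤ
  t k j = sgn (suc j) * (+ j) ^ k

  S≡Σt : ∀ k N → S k N ≡ Σ (t k) N
  S≡Σt k zero    = refl
  S≡Σt k (suc N) = cong (_+ t k (suc N)) (S≡Σt k N)

  sgn-mirror : ∀ j j' m → j +ℕ j' ≡ m → sgn (suc j') ≡ sgn m * sgn (suc j)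
  sgn-mirror j j' m j+j'≡m = begin
    sgn (suc j')                    ≡⟨ sym (ℤ.*-identityʳ (sgn (suc j'))) ⟩
    sgn (suc j') * 1ℤ               ≡⟨ cong (sgn (suc j') *_) (sym (sgn-even j)) ⟩
    sgn (suc j') * sgn (j +ℕ j)     ≡⟨ sym (sgn-+ (suc j') (j +ℕ j)) ⟩
    sgn (suc j' +ℕ (j +ℕ j))        ≡⟨ cong sgn (trans (regroup j j') (cong (_+ℕ suc j) j+j'≡m)) ⟩
    sgn (m +ℕ suc j)                ≡⟨ sgn-+ m (suc j) ⟩
    sgn m * sgn (suc j)             ∎
    where
    regroup : ∀ j j' → suc j' +ℕ (j +ℕ j) ≡ (j +ℕ j') +ℕ suc j
    regroup = solveℕ-∀

  pos-mirror : ∀ j j' m → j +ℕ j' ≡ m → + j' ≡ - + j + + m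
  pos-mirror j j' m j+j'≡m = begin
    + j'                  ≡⟨ regroup (+ j) (+ j') ⟩
    - + j + (+ j + + j')  ≡⟨ cong (λ x → - + j + x) (sym (ℤ.pos-+ j j')) ⟩
    - + j + + (j +ℕ j')   ≡⟨ cong (λ n → - + j + + n) j+j'≡m ⟩
    - + j + + m           ∎
    where
    regroup : ∀ a b → b ≡ - a + (a + b)
    regroup = solve-∀

  -- Mirror pairing for an even exponent e: if j + j' = m then
  -- t e j' ≡ (-1)^m t e j (mod m), since (m - j)^e ≡ j^e (mod m).
  term-mirror : ∀ e j j' m → sgn e ≡ 1ℤ → j +ℕ j' ≡ m → t e j' ≡ sgn m * t e j mod + m
  term-mirror e j j' m e-even j+j'≡m = ∣-≡ (∣n⇒∣m*n (σ * s) power) (begin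
    (σ * s) * ((- J + M) ^ e - J ^ e)     ≡⟨ expand σ s ((- J + M) ^ e) (J ^ e) ⟩
    (σ * s) * (- J + M) ^ e - σ * t e j   ≡⟨ cong₂ (λ a b → a * b ^ e - σ * t e j)
                                                   (sym (sgn-mirror j j' m j+j'≡m))
                                                   (sym (pos-mirror j j' m j+j'≡m)) ⟩
    t e j' - σ * t e j                    ∎)
    where
    J M σ s : ℤ
    J = + j
    M = + m
    σ = sgn m
    s = sgn (suc j)
    power : M ∣ (- J + M) ^ e - J ^ e
    power = ∣-≡ (pow-cong M (- J) e) (cong (λ p → (- J + M) ^ e - p) (neg-pow-even J e e-even))
    expand : ∀ σ s P Y → (σ * s) * (P - Y) ≡ (σ * s) * P - σ * (s * Y)
    expand = solve-∀

  -- Mirror pairing for an odd exponent k = e + 1, to second order: if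
  -- j + j' = m then t k j' ≡ (-1)^m (k m t e j - t k j) (mod m²), since
  -- (m - j)^k ≡ -j^k + k m j^e (mod m²).
  term-mirror-sq : ∀ e j j' m → sgn e ≡ 1ℤ → j +ℕ j' ≡ m →
                   t (suc e) j' ≡ sgn m * (+ suc e * + m * t e j - t (suc e) j) mod + m * + m
  term-mirror-sq e j j' m e-even j+j'≡m = ∣-≡ (∣n⇒∣m*n (σ * s) power) (begin
    (σ * s) * ((- J + M) ^ suc e - (- J * J ^ e + K * M * J ^ e))
        ≡⟨ expand σ s ((- J + M) ^ suc e) J (J ^ e) K M ⟩
    (σ * s) * (- J + M) ^ suc e - σ * (K * M * t e j - t (suc e) j)
        ≡⟨ cong₂ (λ a b → a * b ^ suc e - σ * (K * M * t e j - t (suc e) j))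
                 (sym (sgn-mirror j j' m j+j'≡m)) (sym (pos-mirror j j' m j+j'≡m)) ⟩
    t (suc e) j' - σ * (K * M * t e j - t (suc e) j)
        ∎)
    where
    J M K σ s : ℤ
    J = + j
    M = + m
    K = + suc e
    σ = sgn m
    s = sgn (suc j)
    power : M * M ∣ (- J + M) ^ suc e - (- J * J ^ e + K * M * J ^ e)
    power = ∣-≡ (pow-cong-sq M (- J) e)
                (cong (λ p → (- J + M) ^ suc e - (- J * p + K * M * p)) (neg-pow-even J e e-even))
    expand : ∀ σ s P J Y K M → (σ * s) * (P - (- J * Y + K * M * Y))
                             ≡ (σ * s) * P - σ * (K * M * (s * Y) - s * (J * Y))
    expand = solve-∀

  -- Shift pairing for an odd modulus d: t k (j + d) ≡ - t k j (mod d),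
  -- since the signs are opposite and (j + d)^k ≡ j^k (mod d).
  term-shift : ∀ k h j → + suc (h +ℕ h) ∣ t k (j +ℕ suc (h +ℕ h)) + t k j
  term-shift k h j = ∣-≡ (∣n⇒∣m*n (- s) (pow-cong D J k)) (begin
    - s * ((J + D) ^ k - J ^ k)               ≡⟨ expand s ((J + D) ^ k) (J ^ k) ⟩
    (s * -1ℤ) * (J + D) ^ k + t k j           ≡⟨ cong₂ (λ a b → a * b ^ k + t k j)
                                                       (sym sign) (sym (ℤ.pos-+ j d)) ⟩
    t k (j +ℕ d) + t k j                      ∎)
    where
    d : ℕ
    d = suc (h +ℕ h)
    J D s : ℤ
    J = + j
    D = + d
    s = sgn (suc j)
    sign : sgn (suc (j +ℕ d)) ≡ s * -1ℤ
    sign = trans (sgn-+ (suc j) d) (cong (s *_) (sgn-odd h))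
    expand : ∀ s P Y → - s * (P - Y) ≡ (s * -1ℤ) * P + s * Y
    expand = solve-∀

module DivisorsOfA where
  open import Data.Nat using (ℕ; zero; suc; _∸_; _<_; s≤s) renaming (_+_ to _+ℕ_)
  import Data.Nat.Properties as ℕ
  open import Data.Nat.Induction using (<-rec)
  open import Data.Integer using (ℤ; +_; -_; _+_; _*_; _-_; _^_; 0ℤ; 1ℤ; -1ℤ)
  import Data.Integer.Properties as ℤ
  open import Data.Integer.Divisibility.Signed
  open import Data.Integer.Tactic.RingSolver using (solve-∀)
  open import Relation.Binary.PropositionalEquality
    using (_≡_; refl; sym; trans; cong; cong₂; subst; module ≡-Reasoning)
  open ≡-Reasoning
  open import Defs using (sgn; S; A)
  open Arithmetic using (even; odd; even-or-odd; 2∣h+h)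
  open Congruences
  open AlternatingSums

  A-step : ∀ k m → A k (suc (suc m)) ≡ (+ suc m) ^ k - A k (suc m)
  A-step k m = begin
    (-1ℤ * s) * (S k m + (-1ℤ * s) * P) ≡⟨ expand s (S k m) P ⟩
    (s * s) * P - s * S k m             ≡⟨ cong (λ x → x * P - s * S k m) (sgn-sq (suc m)) ⟩
    1ℤ * P - s * S k m                  ≡⟨ cong (_- s * S k m) (ℤ.*-identityˡ P) ⟩
    P - s * S k m                       ∎
    where
    s P : ℤ
    s = sgn (suc m)
    P = (+ suc m) ^ k
    expand : ∀ s X P → (-1ℤ * s) * (X + (-1ℤ * s) * P) ≡ (s * s) * P - s * X
    expand = solve-∀

  -- If n = 2d + 1 with d odd, then d ∣ A k n: the 2d terms of the sum cancel
  -- in pairs j, j + d modulo d.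
  A-odd-shift : ∀ k h → let d = suc (h +ℕ h) in + d ∣ A k (suc (d +ℕ d))
  A-odd-shift k h =
    ∣n⇒∣m*n (sgn (suc (d +ℕ d)))
            (∣-≡ (antiperiodic (+ d) (t k) d (term-shift k h)) (sym (S≡Σt k (d +ℕ d))))
    where
    d : ℕ
    d = suc (h +ℕ h)

  -- For even e and odd d = 2h + 1, d ∣ S e (d - 1): the terms j and d - j
  -- cancel modulo d, so d divides twice the sum.
  S-odd-mirror : ∀ e h → sgn e ≡ 1ℤ → + suc (h +ℕ h) ∣ S e (h +ℕ h)
  S-odd-mirror e h e-even = odd-cancel-2 h (S e (h +ℕ h)) (∣-≡ twice (begin
    Σ (t e) (h +ℕ h) + Σ (t e) (h +ℕ h) - (0ℤ + 0ℤ * Σ (t e) (h +ℕ h))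
      ≡⟨ double (Σ (t e) (h +ℕ h)) ⟩
    + 2 * Σ (t e) (h +ℕ h)
      ≡⟨ cong (+ 2 *_) (sym (S≡Σt e (h +ℕ h))) ⟩
    + 2 * S e (h +ℕ h)
      ∎))
    where
    D : ℤ
    D = + suc (h +ℕ h)
    pair : ∀ j j' → j +ℕ j' ≡ suc (h +ℕ h) → t e j + t e j' ≡ 0ℤ * t e j mod D
    pair j j' j+j'≡d =
      ∣-≡ (term-mirror e j j' (suc (h +ℕ h)) e-even j+j'≡d)
          (trans (cong (λ σ → t e j' - σ * t e j) (sgn-odd h)) (cancel (t e j) (t e j')))
      where
      cancel : ∀ a b → b - -1ℤ * a ≡ a + b - 0ℤ * a
      cancel = solve-∀
    twice : Σ (t e) (h +ℕ h) + Σ (t e) (h +ℕ h) ≡ Σ (t e) 0 + 0ℤ * Σ (t e) (h +ℕ h) mod D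
    twice = mirror D 0ℤ (t e) (t e) (h +ℕ h) pair (h +ℕ h) 0 (ℕ.+-identityʳ (h +ℕ h))
    double : ∀ X → X + X - (0ℤ + 0ℤ * X) ≡ + 2 * X
    double = solve-∀

  -- For even k ≥ 2 and even n ≥ 2, n - 1 ∣ A k n: the sum up to n - 2 is
  -- divisible by n - 1 as above, and so is the last term ±(n - 1)^k.
  A-even-exponent : ∀ g c → let k = suc g +ℕ suc g in + suc (c +ℕ c) ∣ A k (suc c +ℕ suc c)
  A-even-exponent g c =
    ∣n⇒∣m*n (sgn (suc c +ℕ suc c)) (∣-≡ (∣m∣n⇒∣m+n (S-odd-mirror k c (sgn-even (suc g))) last)
                                        (cong (S k) (sym (ℕ.+-suc c c))))
    where
    k : ℕ
    k = suc g +ℕ suc g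
    last : + suc (c +ℕ c) ∣ t k (suc (c +ℕ c))
    last = ∣n⇒∣m*n (sgn (suc (suc (c +ℕ c)))) (∣m⇒∣m*n ((+ suc (c +ℕ c)) ^ (g +ℕ suc g)) ∣-refl)

  pow-odd-base : ∀ h e → let C = + suc (h +ℕ h) in C ^ suc e ≡ C mod + 2 * C
  pow-odd-base h e = ∣-≡ (≡-∣ (ℤ.*-comm C (+ 2)) (*-monoʳ-∣ C two∣pow-1)) (factor C (C ^ e))
    where
    C : ℤ
    C = + suc (h +ℕ h)
    two∣pow-1 : + 2 ∣ C ^ e - 1ℤ
    two∣pow-1 = ∣-trans (∣ᵤ⇒∣ (2∣h+h h)) (∣-≡ (pow-cong (+ (h +ℕ h)) 1ℤ e) (cong (λ x → C ^ e - x) (ℤ.^-zeroˡ e)))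
    factor : ∀ C P → C * (P - 1ℤ) ≡ C * P - C
    factor = solve-∀

  pow-even-base : ∀ h g → let C = + (suc h +ℕ suc h) in + 2 * C ∣ C ^ (suc g +ℕ suc g)
  pow-even-base h g = divides (H * (C ^ g * C ^ g)) (begin
    C ^ (suc g +ℕ suc g)              ≡⟨ ℤ.^-distribˡ-+-* C (suc g) (suc g) ⟩
    (C * C ^ g) * (C * C ^ g)         ≡⟨ subst (λ x → (x * P) * (x * P) ≡ (H * (P * P)) * (+ 2 * x))
                                               (sym (ℤ.pos-+ (suc h) (suc h))) (regroup H P) ⟩
    (H * (C ^ g * C ^ g)) * (+ 2 * C) ∎)
    where
    H C P : ℤ
    H = + suc h
    C = + (suc h +ℕ suc h)
    P = C ^ g
    regroup : ∀ H P → ((H + H) * P) * ((H + H) * P) ≡ (H * (P * P)) * (+ 2 * (H + H))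
    regroup = solve-∀

  -- Folding the sum about its middle term: for even e and c ≥ 1, the terms
  -- j and 2c - j agree modulo 2c, so
  -- S e (2c - 1) ≡ 2 S e (c - 1) + t e c  (mod 2c).
  S-fold : ∀ e c₀ → sgn e ≡ 1ℤ → let c = suc c₀ in
           S e (c₀ +ℕ c) ≡ + 2 * S e c₀ + t e c mod + 2 * + c
  S-fold e c₀ e-even =
    ≡-∣ (trans (ℤ.pos-+ c c) (double (+ c)))
        (∣-≡ folded (trans (regroup (Σ (t e) c₀) (Σ (t e) (c₀ +ℕ c)) (t e c))
                           (sym (cong₂ (λ X Y → X - (+ 2 * Y + t e c)) (S≡Σt e (c₀ +ℕ c)) (S≡Σt e c₀)))))
    where
    c : ℕ
    c = suc c₀
    pair : ∀ j j' → j +ℕ j' ≡ c +ℕ c → t e j + t e j' ≡ + 2 * t e j mod + (c +ℕ c)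
    pair j j' j+j'≡2c =
      ∣-≡ (term-mirror e j j' (c +ℕ c) e-even j+j'≡2c)
          (trans (cong (λ σ → t e j' - σ * t e j) (sgn-even c)) (swap (t e j) (t e j')))
      where
      swap : ∀ a b → b - 1ℤ * a ≡ a + b - + 2 * a
      swap = solve-∀
    folded : Σ (t e) c₀ + Σ (t e) (c₀ +ℕ c) ≡ Σ (t e) c + + 2 * Σ (t e) c₀ mod + (c +ℕ c)
    folded = mirror (+ (c +ℕ c)) (+ 2) (t e) (t e) (c₀ +ℕ c) pair c₀ c refl
    regroup : ∀ X Y a → X + Y - ((X + a) + + 2 * X) ≡ Y - (+ 2 * X + a)
    regroup = solve-∀
    double : ∀ x → x + x ≡ + 2 * x
    double = solve-∀

  HalfSum : ℕ → ℕ → Set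
  HalfSum e c = S e (c +ℕ c ∸ 1) ≡ + c mod + 2 * + c

  -- Odd c: the fold gives S e (2c - 1) ≡ 2 S e (c - 1) + c^e, where
  -- c ∣ S e (c - 1) by S-odd-mirror and c^e ≡ c (mod 2c).
  half-sum-odd : ∀ g h → HalfSum (suc g +ℕ suc g) (suc (h +ℕ h))
  half-sum-odd g h =
    ∣-≡ (∣m∣n⇒∣m+n (∣m∣n⇒∣m+n (S-fold e (h +ℕ h) (sgn-even (suc g))) twice) power)
        (trans (cong (λ σ → S e (h +ℕ h +ℕ c) - (+ 2 * S e (h +ℕ h) + σ * C ^ e) + + 2 * S e (h +ℕ h)
                            + (C ^ e - C)) sign)
               (regroup (S e (h +ℕ h +ℕ c)) (S e (h +ℕ h)) (C ^ e) C))
    where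
    e c : ℕ
    e = suc g +ℕ suc g
    c = suc (h +ℕ h)
    C : ℤ
    C = + c
    sign : sgn (suc c) ≡ 1ℤ
    sign = trans (sgn-+ 2 (h +ℕ h)) (cong (sgn 2 *_) (sgn-even h))
    twice : + 2 * C ∣ + 2 * S e (h +ℕ h)
    twice = *-monoʳ-∣ (+ 2) (S-odd-mirror e h (sgn-even (suc g)))
    power : + 2 * C ∣ C ^ e - C
    power = pow-odd-base h (g +ℕ suc g)
    regroup : ∀ X Y P C → X - (+ 2 * Y + 1ℤ * P) + + 2 * Y + (P - C) ≡ X - C
    regroup = solve-∀

  -- Even c = 2c': the fold gives S e (2c - 1) ≡ 2 S e (c - 1) - c^e, where
  -- S e (c - 1) ≡ c' (mod 2c') is the claim for c' and c^e ≡ 0 (mod 2c).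
  half-sum-double : ∀ g h → let e = suc g +ℕ suc g in HalfSum e (suc h) → HalfSum e (suc h +ℕ suc h)
  half-sum-double g h half =
    ∣-≡ (∣m∣n⇒∣m+n (∣m∣n⇒∣m+n (S-fold e (h +ℕ suc h) (sgn-even (suc g))) (≡-∣ modulus twice))
                   (∣m⇒∣-m (pow-even-base h g)))
        (trans (cong (λ σ → S e (h +ℕ suc h +ℕ c) - (+ 2 * S e (h +ℕ suc h) + σ * C ^ e)
                            + + 2 * (S e (h +ℕ suc h) - H) + - C ^ e) sign)
               (trans (regroup (S e (h +ℕ suc h +ℕ c)) (S e (h +ℕ suc h)) (C ^ e) H)
                      (cong (λ x → S e (h +ℕ suc h +ℕ c) - x) (sym (ℤ.pos-+ (suc h) (suc h))))))
    where
    e c : ℕ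
    e = suc g +ℕ suc g
    c = suc h +ℕ suc h
    H C : ℤ
    H = + suc h
    C = + c
    sign : sgn (suc c) ≡ -1ℤ
    sign = sgn-odd (suc h)
    twice : + 2 * (+ 2 * H) ∣ + 2 * (S e (h +ℕ suc h) - H)
    twice = *-monoʳ-∣ (+ 2) half
    modulus : + 2 * (+ 2 * H) ≡ + 2 * C
    modulus = cong (+ 2 *_) (trans (double H) (sym (ℤ.pos-+ (suc h) (suc h))))
      where
      double : ∀ x → + 2 * x ≡ x + x
      double = solve-∀
    regroup : ∀ X Y P H → X - (+ 2 * Y + -1ℤ * P) + + 2 * (Y - H) + - P ≡ X - (H + H)
    regroup = solve-∀

  S-even-half : ∀ g c → HalfSum (suc g +ℕ suc g) c
  S-even-half g = <-rec (HalfSum (suc g +ℕ suc g)) half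
    where
    half : ∀ c → (∀ {c'} → c' < c → HalfSum (suc g +ℕ suc g) c') → HalfSum (suc g +ℕ suc g) c
    half c smaller with even-or-odd c
    ... | even zero    = ∣-zero 0ℤ
    ... | even (suc h) = half-sum-double g h (smaller (s≤s (ℕ.m≤n+m (suc h) h)))
    ... | odd h        = half-sum-odd g h

  -- Pairing j with n - j to second order: for odd k = e + 1 ≥ 3 and n = 2c,
  -- 2 S k (n - 1) ≡ k n S e (n - 1) (mod n²).
  S-mirror-sq : ∀ g c₀ → let e = suc g +ℕ suc g ; c = suc c₀ ; N = + (c +ℕ c) ; D = c₀ +ℕ c in
                + 2 * S (suc e) D ≡ + suc e * N * S e D mod N * N
  S-mirror-sq g c₀ =
    ∣-≡ (mirror (N * N) (K * N) (t k) (t e) D pair D 0 (ℕ.+-identityʳ D))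
        (trans (regroup (Σ (t k) D) (Σ (t e) D) K N)
               (cong₂ (λ X Y → + 2 * X - K * N * Y) (sym (S≡Σt k D)) (sym (S≡Σt e D))))
    where
    e k c D : ℕ
    e = suc g +ℕ suc g
    k = suc e
    c = suc c₀
    D = c₀ +ℕ c
    K N : ℤ
    K = + k
    N = + (c +ℕ c)
    pair : ∀ j j' → j +ℕ j' ≡ c +ℕ c → t k j + t k j' ≡ K * N * t e j mod N * N
    pair j j' j+j'≡n =
      ∣-≡ (term-mirror-sq e j j' (c +ℕ c) (sgn-even (suc g)) j+j'≡n)
          (trans (cong (λ σ → t k j' - σ * (K * N * t e j - t k j)) (sgn-even c))
                 (swap (t k j) (t k j') (t e j) K N))
      where
      swap : ∀ a b x K N → b - 1ℤ * (K * N * x - a) ≡ a + b - K * N * x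
      swap = solve-∀
    regroup : ∀ X Y K N → X + X - (0ℤ + K * N * Y) ≡ + 2 * X - K * N * Y
    regroup = solve-∀

  -- For odd k = e + 1 ≥ 3 and n = 2c with c ≥ 1: A k n ≡ k c² (mod 2c²),
  -- from S-mirror-sq and S e (n - 1) ≡ c (mod n).
  A-odd-exponent : ∀ g c₀ → let k = suc (suc g +ℕ suc g) ; C = + suc c₀ in
                   A k (suc c₀ +ℕ suc c₀) ≡ + k * (C * C) mod + 2 * (C * C)
  A-odd-exponent g c₀ =
    *-cancelˡ-∣ (+ 2) (≡-∣ (quadruple C) (∣-≡ combined (begin
      + 2 * Sₖ - K * (C + C) * Sₑ + K * ((C + C) * (Sₑ - C))  ≡⟨ regroup Sₖ Sₑ K C ⟩
      + 2 * (Sₖ - K * (C * C))                               ≡⟨ cong (λ x → + 2 * (x - K * (C * C))) Sₖ≡A ⟩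
      + 2 * (A k (c +ℕ c) - K * (C * C))                     ∎)))
    where
    e k c : ℕ
    e = suc g +ℕ suc g
    k = suc e
    c = suc c₀
    C K N Sₖ Sₑ : ℤ
    C = + c
    K = + k
    N = + (c +ℕ c)
    Sₖ = S k (c₀ +ℕ c)
    Sₑ = S e (c₀ +ℕ c)
    N≡C+C : N ≡ C + C
    N≡C+C = ℤ.pos-+ c c
    half : N ∣ Sₑ - C
    half = ≡-∣ (trans (double C) (sym N≡C+C)) (S-even-half g c)
      where
      double : ∀ x → + 2 * x ≡ x + x
      double = solve-∀
    combined : (C + C) * (C + C) ∣ + 2 * Sₖ - K * (C + C) * Sₑ + K * ((C + C) * (Sₑ - C))
    combined = subst (λ M → M * M ∣ + 2 * Sₖ - K * M * Sₑ + K * (M * (Sₑ - C))) N≡C+C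
                     (∣m∣n⇒∣m+n (S-mirror-sq g c₀) (∣n⇒∣m*n K (*-monoʳ-∣ N half)))
    Sₖ≡A : Sₖ ≡ A k (c +ℕ c)
    Sₖ≡A = trans (sym (ℤ.*-identityˡ Sₖ)) (cong (_* Sₖ) (sym (sgn-even c)))
    regroup : ∀ X Y K C → + 2 * X - K * (C + C) * Y + K * ((C + C) * (Y - C)) ≡ + 2 * (X - K * (C * C))
    regroup = solve-∀
    quadruple : ∀ C → (C + C) * (C + C) ≡ + 2 * (+ 2 * (C * C))
    quadruple = solve-∀

module NaturalValues where
  open import Data.Nat
  open import Data.Nat.Properties
  open import Data.Nat.Divisibility
  open import Data.Nat.Tactic.RingSolver using (solve-∀)
  open import Data.Integer as ℤ using (ℤ)
  import Data.Integer.Properties as ℤₚ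
  import Data.Integer.Divisibility as ℤᵘ
  import Data.Integer.Divisibility.Signed as ℤ∣
  open import Function.Bundles using (_⇔_; mk⇔)
  open import Relation.Binary.PropositionalEquality
  open import Defs using (A)
  open Congruences using (pos-pow)
  open DivisorsOfA using (A-step)

  a : ℕ → ℕ → ℕ
  a k zero          = 0
  a k (suc zero)    = 0
  a k (suc (suc m)) = suc m ^ k ∸ a k (suc m)

  a≤pow : ∀ k m → a k (suc m) ≤ suc m ^ k
  a≤pow k zero    = z≤n
  a≤pow k (suc m) = ≤-trans (m∸n≤m (suc m ^ k) (a k (suc m))) (^-monoˡ-≤ k (n≤1+n (suc m)))

  -- Consecutive values add up to a power, so the subtraction never truncates.
  a-sum : ∀ k m → a k (suc m) + a k (suc (suc m)) ≡ suc m ^ k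
  a-sum k m = m+[n∸m]≡n (a≤pow k m)

  A≡a : ∀ k m → A k m ≡ ℤ.+ a k m
  A≡a k zero          = refl
  A≡a k (suc zero)    = refl
  A≡a k (suc (suc m)) = begin
    A k (suc (suc m))                    ≡⟨ A-step k m ⟩
    (ℤ.+ suc m) ℤ.^ k ℤ.- A k (suc m)    ≡⟨ cong₂ ℤ._-_ (pos-pow (suc m) k) (A≡a k (suc m)) ⟩
    ℤ.+ (suc m ^ k) ℤ.- ℤ.+ a k (suc m)  ≡⟨ ℤₚ.m-n≡m⊖n (suc m ^ k) (a k (suc m)) ⟩
    suc m ^ k ℤ.⊖ a k (suc m)            ≡⟨ ℤₚ.⊖-≥ (a≤pow k m) ⟩
    ℤ.+ a k (suc (suc m))                ∎
    where open ≡-Reasoning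

  ∣A⇒∣a : ∀ {d} k n → ℤ.+ d ℤ∣.∣ A k n → d ∣ a k n
  ∣A⇒∣a {d} k n d∣A = subst (d ∣_) (cong ℤ.∣_∣ (A≡a k n)) (ℤ∣.∣⇒∣ᵤ d∣A)

  A∣A⇔a∣a : ∀ k n → A k n ℤᵘ.∣ A k (suc n) ⇔ a k n ∣ a k (suc n)
  A∣A⇔a∣a k n = mk⇔ (subst₂ _∣_ (abs n) (abs (suc n))) (subst₂ _∣_ (sym (abs n)) (sym (abs (suc n))))
    where
    abs : ∀ m → ℤ.∣ A k m ∣ ≡ a k m
    abs m = cong ℤ.∣_∣ (A≡a k m)

  -- Since a k n + a k (n + 1) = n^k, a k n divides a k (n + 1) exactly when
  -- it divides n^k.
  ∣next⇔∣pow : ∀ k m → a k (suc m) ∣ a k (suc (suc m)) ⇔ a k (suc m) ∣ suc m ^ k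
  ∣next⇔∣pow k m = mk⇔
    (λ ∣next → subst (a k (suc m) ∣_) (a-sum k m) (∣m∣n⇒∣m+n ∣-refl ∣next))
    (λ ∣pow → ∣m+n∣m⇒∣n (subst (a k (suc m) ∣_) (sym (a-sum k m)) ∣pow) ∣-refl)

  convex : ∀ m k → 2 * suc m ^ k ≤ m ^ k + suc (suc m) ^ k
  convex m zero    = ≤-refl
  convex m (suc k) = +-cancelʳ-≤ X (2 * (suc m * Y)) (m * X + suc (suc m) * Z) (begin
    2 * (suc m * Y) + X          ≡⟨ cong (_+ X) (swap m Y) ⟩
    suc m * (2 * Y) + X          ≤⟨ +-mono-≤ (*-monoʳ-≤ (suc m) (convex m k))
                                             (^-monoˡ-≤ k (≤-trans (n≤1+n m) (n≤1+n (suc m)))) ⟩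
    suc m * (X + Z) + Z          ≡⟨ regroup m X Z ⟩
    m * X + suc (suc m) * Z + X  ∎)
    where
    open ≤-Reasoning
    X Y Z : ℕ
    X = m ^ k
    Y = suc m ^ k
    Z = suc (suc m) ^ k
    swap : ∀ m Y → 2 * ((1 + m) * Y) ≡ (1 + m) * (2 * Y)
    swap = solve-∀
    regroup : ∀ m X Z → (1 + m) * (X + Z) + Z ≡ m * X + (2 + m) * Z + X
    regroup = solve-∀

  -- Bounds on a k n.  As (m+1)^k = a k (m+1) + a k (m+2), if the first
  -- summand is less than half of the power then the second is more.
  lower-from-upper : ∀ k m → 2 * a k (suc m) < suc m ^ k → suc m ^ k < 2 * a k (suc (suc m))
  lower-from-upper k m 2u<P = begin-strict
    suc m ^ k  ≡⟨ sym (a-sum k m) ⟩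
    u + v      <⟨ +-monoˡ-< v u<v ⟩
    v + v      ≡⟨ cong (v +_) (sym (+-identityʳ v)) ⟩
    2 * v      ∎
    where
    open ≤-Reasoning
    u v : ℕ
    u = a k (suc m)
    v = a k (suc (suc m))
    u<v : u < v
    u<v = +-cancelˡ-< u u v (begin-strict
      u + u      ≡⟨ cong (u +_) (sym (+-identityʳ u)) ⟩
      2 * u      <⟨ 2u<P ⟩
      suc m ^ k  ≡⟨ sym (a-sum k m) ⟩
      u + v      ∎)

  upper-from-lower : ∀ k m → 2 * suc m ^ k < 2 * a k (suc m) + suc (suc m) ^ k →
                     2 * a k (suc (suc m)) < suc (suc m) ^ k
  upper-from-lower k m 2P<2u+Q = +-cancelˡ-< (2 * u) (2 * v) Q (begin-strict
    2 * u + 2 * v  ≡⟨ sym (*-distribˡ-+ 2 u v) ⟩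
    2 * (u + v)    ≡⟨ cong (2 *_) (a-sum k m) ⟩
    2 * suc m ^ k  <⟨ 2P<2u+Q ⟩
    2 * u + Q      ∎)
    where
    open ≤-Reasoning
    u v Q : ℕ
    u = a k (suc m)
    v = a k (suc (suc m))
    Q = suc (suc m) ^ k

  -- For k ≥ 2: 2 a k (m+1) < (m+1)^k, by induction using convexity.
  a-upper : ∀ j m → 2 * a (2 + j) (suc m) < suc m ^ (2 + j)
  a-upper j zero          = subst (0 <_) (sym (^-zeroˡ (2 + j))) z<s
  a-upper j (suc zero)    = upper-from-lower (2 + j) 0 (begin-strict
    2 * 1 ^ (2 + j)  ≡⟨ cong (2 *_) (^-zeroˡ (2 + j)) ⟩
    2                <⟨ *-monoʳ-< 2 (*-monoʳ-≤ 2 (m^n>0 2 j)) ⟩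
    2 ^ (2 + j)      ∎)
    where open ≤-Reasoning
  a-upper j (suc (suc m)) = upper-from-lower (2 + j) (suc m) (begin-strict
    2 * (2 + m) ^ (2 + j)                   ≤⟨ convex (suc m) (2 + j) ⟩
    (1 + m) ^ (2 + j) + (3 + m) ^ (2 + j)   <⟨ +-monoˡ-< ((3 + m) ^ (2 + j))
                                                 (lower-from-upper (2 + j) m (a-upper j m)) ⟩
    2 * a (2 + j) (2 + m) + (3 + m) ^ (2 + j) ∎)
    where open ≤-Reasoning

  a-lower : ∀ j m → suc m ^ (2 + j) < 2 * a (2 + j) (suc (suc m))
  a-lower j m = lower-from-upper (2 + j) m (a-upper j m)

module Obstructions where
  open import Data.Nat
  open import Data.Nat.Properties
  open import Data.Nat.Divisibility
  open import Data.Nat.Coprimality using (Coprime; coprime-divisor)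
  open import Data.Nat.DivMod using (_%_; [m+kn]%n≡m%n; %-distribˡ-*)
  open import Data.Nat.Primality using (prime?; prime⇒irreducible)
  open import Data.Nat.Tactic.RingSolver using (solve-∀)
  open import Data.Integer as ℤ using (ℤ)
  import Data.Integer.Properties as ℤₚ
  import Data.Integer.Divisibility.Signed as ℤ∣
  open import Data.Integer.Tactic.RingSolver renaming (solve-∀ to solveℤ-∀)
  open import Data.Product using (_×_; _,_; Σ)
  open import Data.Sum using (_⊎_; inj₁; inj₂)
  open import Data.Empty using (⊥-elim)
  open import Relation.Nullary using (¬_; yes; no)
  open import Relation.Nullary.Decidable using (from-yes)
  open import Relation.Binary.PropositionalEquality
  open import Defs using (A)
  open Arithmetic
  open Congruences using (∣-≡; ≡-∣)
  open DivisorsOfA using (A-odd-exponent)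
  open NaturalValues

  odd-pow-odd : ∀ h k → Σ ℕ λ r → suc (h + h) ^ k ≡ suc (r + r)
  odd-pow-odd h zero    = 0 , refl
  odd-pow-odd h (suc k) with odd-pow-odd h k
  ... | r , hᵏ≡2r+1 = h + r + 2 * h * r , trans (cong (suc (h + h) *_) hᵏ≡2r+1) (expand h r)
    where
    expand : ∀ h r → suc (h + h) * suc (r + r) ≡ suc ((h + r + 2 * h * r) + (h + r + 2 * h * r))
    expand = solve-∀

  odd-pow-sum : ∀ h h' k → 2 ∣ suc (h + h) ^ k + suc (h' + h') ^ k
  odd-pow-sum h h' k with odd-pow-odd h k | odd-pow-odd h' k
  ... | r , p | r' , p' = divides (suc (r + r')) (trans (cong₂ _+_ p p') (regroup r r'))
    where
    regroup : ∀ r r' → suc (r + r) + suc (r' + r') ≡ suc (r + r') * 2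
    regroup = solve-∀

  a-two-step : ∀ k m → a k (3 + m) + suc m ^ k ≡ a k (suc m) + (2 + m) ^ k
  a-two-step k m = begin
    a k (3 + m) + suc m ^ k                    ≡⟨ cong (a k (3 + m) +_) (sym (a-sum k m)) ⟩
    a k (3 + m) + (a k (1 + m) + a k (2 + m))  ≡⟨ rotate (a k (3 + m)) (a k (1 + m)) (a k (2 + m)) ⟩
    a k (1 + m) + (a k (2 + m) + a k (3 + m))  ≡⟨ cong (a k (1 + m) +_) (a-sum k (suc m)) ⟩
    a k (suc m) + (2 + m) ^ k                  ∎
    where
    open ≡-Reasoning
    rotate : ∀ x y z → x + (y + z) ≡ y + (z + x)
    rotate = solve-∀

  -- For k ≥ 1, a k (4g + 1) is even: over four steps the recurrence adds
  -- two even and two odd powers.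
  a-even : ∀ k g → 2 ∣ a (suc k) (suc ((g + g) + (g + g)))
  a-even k zero    = divides 0 refl
  a-even k (suc g) = subst (λ n → 2 ∣ a K (suc n)) (sym (shape g)) (∣m+n∣m⇒∣n four-steps odd-sum)
    where
    K m : ℕ
    K = suc k
    m = (g + g) + (g + g)
    shape : ∀ g → (suc g + suc g) + (suc g + suc g) ≡ 4 + ((g + g) + (g + g))
    shape = solve-∀
    combined : ((3 + m) ^ K + (1 + m) ^ K) + a K (5 + m) ≡ (a K (1 + m) + (2 + m) ^ K) + (4 + m) ^ K
    combined = begin
      ((3 + m) ^ K + (1 + m) ^ K) + a K (5 + m)  ≡⟨ +-comm _ (a K (5 + m)) ⟩
      a K (5 + m) + ((3 + m) ^ K + (1 + m) ^ K)  ≡⟨ sym (+-assoc (a K (5 + m)) _ _) ⟩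
      (a K (5 + m) + (3 + m) ^ K) + (1 + m) ^ K  ≡⟨ cong (_+ (1 + m) ^ K) (a-two-step K (2 + m)) ⟩
      (a K (3 + m) + (4 + m) ^ K) + (1 + m) ^ K  ≡⟨ swap (a K (3 + m)) ((4 + m) ^ K) ((1 + m) ^ K) ⟩
      (a K (3 + m) + (1 + m) ^ K) + (4 + m) ^ K  ≡⟨ cong (_+ (4 + m) ^ K) (a-two-step K m) ⟩
      (a K (1 + m) + (2 + m) ^ K) + (4 + m) ^ K  ∎
      where
      open ≡-Reasoning
      swap : ∀ x y z → (x + y) + z ≡ (x + z) + y
      swap = solve-∀
    even-pow : ∀ x → 2 ∣ x → 2 ∣ x ^ K
    even-pow x 2∣x = ∣m⇒∣m*n (x ^ k) 2∣x
    four-steps : 2 ∣ ((3 + m) ^ K + (1 + m) ^ K) + a K (5 + m)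
    four-steps = subst (2 ∣_) (sym combined)
      (∣m∣n⇒∣m+n (∣m∣n⇒∣m+n (a-even k g) (even-pow (2 + m) (divides (1 + (g + g)) (half₂ g))))
                 (even-pow (4 + m) (divides (2 + (g + g)) (half₄ g))))
      where
      half₂ : ∀ g → 2 + ((g + g) + (g + g)) ≡ (1 + (g + g)) * 2
      half₂ = solve-∀
      half₄ : ∀ g → 4 + ((g + g) + (g + g)) ≡ (2 + (g + g)) * 2
      half₄ = solve-∀
    odd-sum : 2 ∣ (3 + m) ^ K + (1 + m) ^ K
    odd-sum = subst (λ x → 2 ∣ x ^ K + (1 + m) ^ K) (cong (λ x → suc (suc x)) (+-suc (g + g) (g + g)))
                    (odd-pow-sum (suc (g + g)) (g + g) K)

  coprime-3 : ∀ d → ¬ 3 ∣ d → Coprime d 3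
  coprime-3 d 3∤d {e} (e∣d , e∣3) with prime⇒irreducible (from-yes (prime? 3)) e∣3
  ... | inj₁ e≡1 = e≡1
  ... | inj₂ refl = ⊥-elim (3∤d e∣d)

  pow3-divisor : ∀ k d → d ∣ 3 ^ k → d % 8 ≡ 1 ⊎ d % 8 ≡ 3
  pow3-divisor zero    d d∣1 = inj₁ (cong (_% 8) (∣1⇒≡1 d∣1))
  pow3-divisor (suc k) d d∣3ᵏ⁺¹ with 3 ∣? d
  ... | no 3∤d = pow3-divisor k d (coprime-divisor (coprime-3 d 3∤d) d∣3ᵏ⁺¹)
  ... | yes (divides q refl) with pow3-divisor k q (*-cancelʳ-∣ 3 (subst (q * 3 ∣_) (*-comm 3 (3 ^ k)) d∣3ᵏ⁺¹))
  ...   | inj₁ q≡1 = inj₂ (trans (%-distribˡ-* q 3 8) (cong (λ r → (r * 3) % 8) q≡1))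
  ...   | inj₂ q≡3 = inj₁ (trans (%-distribˡ-* q 3 8) (cong (λ r → (r * 3) % 8) q≡3))

  a-three : ∀ j → a (3 + j) 3 % 8 ≡ 7
  a-three j = begin
    (2 ^ (3 + j) ∸ 1 ^ (3 + j)) % 8   ≡⟨ cong (λ x → (2 ^ (3 + j) ∸ x) % 8) (^-zeroˡ (3 + j)) ⟩
    (2 * (2 * (2 * 2 ^ j)) ∸ 1) % 8   ≡⟨ cong (_% 8) (eight-times (2 ^ j) (m^n>0 2 j)) ⟩
    (7 + (2 ^ j ∸ 1) * 8) % 8         ≡⟨ [m+kn]%n≡m%n 7 (2 ^ j ∸ 1) 8 ⟩
    7                                 ∎
    where
    open ≡-Reasoning
    eight-times : ∀ x → 0 < x → 2 * (2 * (2 * x)) ∸ 1 ≡ 7 + (x ∸ 1) * 8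
    eight-times (suc x) _ = cong (_∸ 1) (expand x)
      where
      expand : ∀ x → 2 * (2 * (2 * suc x)) ≡ suc (7 + x * 8)
      expand = solve-∀

  -- If c² ∣ v, 2c² ∤ v and v ∣ (2c)^(k+2), then v ≤ c^(k+2): the cofactor
  -- v / c² is odd and divides 2^(k+2) c^k, hence divides c^k.
  square-part-bound : ∀ c₀ k v → let c = suc c₀ in
                      c * c ∣ v → ¬ 2 * (c * c) ∣ v → v ∣ (c + c) ^ (2 + k) → v ≤ c ^ (2 + k)
  square-part-bound c₀ k v (divides B v≡Bc²) 2c²∤v v∣[2c]ᵏ⁺² = begin
    v                ≡⟨ v≡Bc² ⟩
    B * (c * c)      ≤⟨ *-monoˡ-≤ (c * c) (∣⇒≤ {{m^n≢0 c k}} B∣cᵏ) ⟩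
    c ^ k * (c * c)  ≡⟨ regroup c (c ^ k) ⟩
    c ^ (2 + k)      ∎
    where
    open ≤-Reasoning
    c : ℕ
    c = suc c₀
    regroup : ∀ c P → P * (c * c) ≡ c * (c * P)
    regroup = solve-∀
    B-odd : ¬ 2 ∣ B
    B-odd (divides h B≡2h) = 2c²∤v (divides h (trans v≡Bc² (trans (cong (_* (c * c)) B≡2h) (*-assoc h 2 (c * c)))))
    B-coprime-2 : Coprime B 2
    B-coprime-2 with even-or-odd B
    ... | even h = ⊥-elim (B-odd (2∣h+h h))
    ... | odd h  = odd-coprime-2 h
    power : (c + c) ^ (2 + k) ≡ (2 ^ (2 + k) * c ^ k) * (c * c)
    power = begin-equality
      (c + c) ^ (2 + k)          ≡⟨ cong (_^ (2 + k)) (cong (c +_) (sym (+-identityʳ c))) ⟩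
      (2 * c) ^ (2 + k)          ≡⟨ pow-* 2 c (2 + k) ⟩
      2 ^ (2 + k) * c ^ (2 + k)  ≡⟨ regroup' (2 ^ (2 + k)) c (c ^ k) ⟩
      (2 ^ (2 + k) * c ^ k) * (c * c) ∎
      where
      regroup' : ∀ T c P → T * (c * (c * P)) ≡ (T * P) * (c * c)
      regroup' = solve-∀
    B∣cᵏ : B ∣ c ^ k
    B∣cᵏ = coprime-pow-divisor (2 + k) (c ^ k) B-coprime-2
             (*-cancelʳ-∣ (c * c) (subst₂ _∣_ v≡Bc² power v∣[2c]ᵏ⁺²))

  double-pow-≤ : ∀ c₁ k → 2 * suc (suc c₁) ^ (2 + k) ≤ suc (c₁ + suc (suc c₁)) ^ (2 + k)
  double-pow-≤ c₁ zero    = subst (2 * (c * (c * 1)) ≤_) (square c₁) (m≤m+n (2 * (c * (c * 1))) (1 + 4 * c₁ + 2 * (c₁ * c₁)))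
    where
    c : ℕ
    c = suc (suc c₁)
    square : ∀ c₁ → 2 * ((2 + c₁) * ((2 + c₁) * 1)) + (1 + 4 * c₁ + 2 * (c₁ * c₁))
                  ≡ (1 + (c₁ + (2 + c₁))) * ((1 + (c₁ + (2 + c₁))) * 1)
    square = solve-∀
  double-pow-≤ c₁ (suc k) = begin
    2 * (c * c ^ (2 + k))  ≡⟨ *-comm-middle 2 c (c ^ (2 + k)) ⟩
    c * (2 * c ^ (2 + k))  ≤⟨ *-monoʳ-≤ c (double-pow-≤ c₁ k) ⟩
    c * d ^ (2 + k)        ≤⟨ *-monoˡ-≤ (d ^ (2 + k)) (m≤n+m c (suc c₁)) ⟩
    d * d ^ (2 + k)        ∎
    where
    open ≤-Reasoning
    c d : ℕ
    c = suc (suc c₁)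
    d = suc (c₁ + suc (suc c₁))
    *-comm-middle : ∀ x y z → x * (y * z) ≡ y * (x * z)
    *-comm-middle = solve-∀

  square-valuation : ∀ g c₀ → let k = suc (suc g + suc g) ; c = suc c₀ in
                   c * c ∣ a k (c + c) × ¬ 2 * (c * c) ∣ a k (c + c)
  square-valuation g c₀ = ∣A⇒∣a k n C²∣A , 2c²∤a
    where
    k c n : ℕ
    k = suc (suc g + suc g)
    c = suc c₀
    n = c + c
    K C² : ℤ
    K  = ℤ.+ k
    C² = ℤ.+ c ℤ.* ℤ.+ c
    congruence : ℤ.+ 2 ℤ.* C² ℤ∣.∣ A k n ℤ.- K ℤ.* C²
    congruence = A-odd-exponent g c₀
    C²∣A : ℤ.+ (c * c) ℤ∣.∣ A k n
    C²∣A = ≡-∣ (sym (ℤₚ.pos-* c c))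
             (∣-≡ (ℤ∣.∣m∣n⇒∣m+n (ℤ∣.∣-trans (ℤ∣.∣n⇒∣m*n (ℤ.+ 2) ℤ∣.∣-refl) congruence) (ℤ∣.∣n⇒∣m*n K ℤ∣.∣-refl))
                  (cancel (A k n) (K ℤ.* C²)))
      where
      cancel : ∀ X Y → X ℤ.- Y ℤ.+ Y ≡ X
      cancel = solveℤ-∀
    2c²∤a : ¬ 2 * (c * c) ∣ a k n
    2c²∤a 2c²∣a = odd-not-even (suc g) (ℤ∣.∣⇒∣ᵤ (ℤ∣.*-cancelʳ-∣ C² {ℤ.+ 2} {K} 2C²∣KC²))
      where
      2C²∣A : ℤ.+ 2 ℤ.* C² ℤ∣.∣ A k n
      2C²∣A = ≡-∣ (trans (ℤₚ.pos-* 2 (c * c)) (cong (ℤ.+ 2 ℤ.*_) (ℤₚ.pos-* c c)))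
                  (∣-≡ (ℤ∣.∣ᵤ⇒∣ 2c²∣a) (sym (A≡a k n)))
      2C²∣KC² : ℤ.+ 2 ℤ.* C² ℤ∣.∣ K ℤ.* C²
      2C²∣KC² = ∣-≡ (ℤ∣.∣m∣n⇒∣m-n 2C²∣A congruence) (cancel (A k n) (K ℤ.* C²))
        where
        cancel : ∀ X Y → X ℤ.- (X ℤ.- Y) ≡ Y
        cancel = solveℤ-∀

module Classification where
  open import Data.Nat
  open import Data.Nat.Properties
  open import Data.Nat.Divisibility
  import Data.Nat.Coprimality as Coprimality
  open import Data.Nat.Tactic.RingSolver using (solve-∀)
  open import Data.Product using (_×_; _,_; proj₁; proj₂)
  open import Data.Sum using (_⊎_; inj₁; inj₂; [_,_])
  open import Data.Empty using (⊥-elim)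
  open import Relation.Nullary using (¬_)
  open import Relation.Binary.PropositionalEquality
    using (_≡_; _≢_; refl; sym; trans; cong; cong₂; subst; module ≡-Reasoning)
  open Arithmetic
  open DivisorsOfA using (A-odd-shift; A-even-exponent)
  open NaturalValues
  open Obstructions

  Condition : ℕ → ℕ → Set
  Condition k n = n ≡ 2 ⊎ (k ≡ 1 × 2 ∣ n) ⊎ ((k ≡ 1 ⊎ k ≡ 2) × n ≡ 3)

  -- Even n ≥ 4 and even k: n - 1 divides a k n and is coprime to n.
  ¬∣pow-even-even : ∀ g c → let k = suc g + suc g ; n = suc (suc c) + suc (suc c) in ¬ a k n ∣ n ^ k
  ¬∣pow-even-even g c a∣nᵏ = d≢1 (coprime-pow k coprime (∣-trans (∣A⇒∣a k n (A-even-exponent g (suc c))) a∣nᵏ))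
    where
    k n : ℕ
    k = suc g + suc g
    n = suc (suc c) + suc (suc c)
    coprime : Coprimality.Coprime (suc (suc c + suc c)) n
    coprime = subst (Coprimality.Coprime _) (cong suc (sym (+-suc (suc c) (suc c)))) (coprime-suc-multiple ∣-refl)
    d≢1 : suc (suc c + suc c) ≢ 1
    d≢1 ()

  -- Even n ≥ 4 and odd k ≥ 3: a k n is too large to divide n^k, since
  -- (n - 1)^k < 2 a k n ≤ 2 (n/2)^k ≤ (n - 1)^k.
  ¬∣pow-even-odd : ∀ g c₁ → let k = suc (suc g + suc g) ; n = suc (suc c₁) + suc (suc c₁) in ¬ a k n ∣ n ^ k
  ¬∣pow-even-odd g c₁ a∣nᵏ = <-irrefl refl (begin-strict
    suc m ^ k   <⟨ a-lower (g + suc g) m ⟩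
    2 * a k n   ≤⟨ *-monoʳ-≤ 2 (square-part-bound (suc c₁) (g + suc g) (a k n) (proj₁ valuation) (proj₂ valuation) a∣nᵏ) ⟩
    2 * c ^ k   ≤⟨ double-pow-≤ c₁ (g + suc g) ⟩
    suc m ^ k   ∎)
    where
    open ≤-Reasoning
    k c n m : ℕ
    k = suc (suc g + suc g)
    c = suc (suc c₁)
    n = c + c
    m = c₁ + suc (suc c₁)
    valuation : c * c ∣ a k n × ¬ 2 * (c * c) ∣ a k n
    valuation = square-valuation g (suc c₁)

  -- n ≡ 1 (mod 4), n ≥ 5: a k n is even while n^k is odd.
  ¬∣pow-1mod4 : ∀ k g → 1 ≤ k → let n = suc ((suc g + suc g) + (suc g + suc g)) in ¬ a k n ∣ n ^ k
  ¬∣pow-1mod4 (suc k) g _ a∣nᵏ =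
    2≢1 (coprime-pow (suc k) (Coprimality.sym (odd-coprime-2 (suc g + suc g))) (∣-trans (a-even k (suc g)) a∣nᵏ))
    where
    2≢1 : 2 ≢ 1
    2≢1 ()

  -- n ≡ 3 (mod 4), n ≥ 7: d = (n - 1)/2 is odd and greater than 1, divides
  -- a k n and is coprime to n.
  ¬∣pow-3mod4 : ∀ k g → let d = suc (suc g + suc g) in ¬ a k (suc (d + d)) ∣ suc (d + d) ^ k
  ¬∣pow-3mod4 k g a∣nᵏ = d≢1 (coprime-pow k (coprime-suc-multiple (∣m∣n⇒∣m+n ∣-refl ∣-refl)) (∣-trans d∣a a∣nᵏ))
    where
    d : ℕ
    d = suc (suc g + suc g)
    d∣a : d ∣ a k (suc (d + d))
    d∣a = ∣A⇒∣a k (suc (d + d)) (A-odd-shift k (suc g))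
    d≢1 : d ≢ 1
    d≢1 ()

  -- n = 3 and k ≥ 3: a k 3 ≡ 7 (mod 8) is not a divisor of 3^k.
  ¬∣pow-three : ∀ j → ¬ a (3 + j) 3 ∣ 3 ^ (3 + j)
  ¬∣pow-three j a∣3ᵏ = [ (λ r≡1 → 7≢1 (trans (sym (a-three j)) r≡1)) , (λ r≡3 → 7≢3 (trans (sym (a-three j)) r≡3)) ]
                         (pow3-divisor (3 + j) (a (3 + j) 3) a∣3ᵏ)
    where
    7≢1 : 7 ≢ 1
    7≢1 ()
    7≢3 : 7 ≢ 3
    7≢3 ()

  a-one-odd : ∀ h → a 1 (suc (h + h)) ≡ h
  a-one-odd zero    = refl
  a-one-odd (suc h) = +-cancelʳ-≡ (suc m) _ _ (begin
    a 1 (suc (suc h + suc h)) + suc m   ≡⟨ cong₂ (λ x y → a 1 (suc x) + y) (cong suc (+-suc h h))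
                                                  (sym (*-identityʳ (suc m))) ⟩
    a 1 (3 + m) + suc m ^ 1             ≡⟨ a-two-step 1 m ⟩
    a 1 (suc m) + (2 + m) ^ 1           ≡⟨ cong₂ _+_ (a-one-odd h) (*-identityʳ (2 + m)) ⟩
    h + (2 + m)                         ≡⟨ +-suc h (suc m) ⟩
    suc h + suc m                       ∎)
    where
    open ≡-Reasoning
    m : ℕ
    m = h + h

  a-one-even : ∀ h → a 1 (suc h + suc h) ≡ suc h
  a-one-even h = +-cancelˡ-≡ h _ _ (begin
    h + a 1 (suc h + suc h)        ≡⟨ cong₂ (λ x y → x + a 1 y) (sym (a-one-odd h)) (+-suc (suc h) h) ⟩
    a 1 (suc m) + a 1 (suc (suc m)) ≡⟨ a-sum 1 m ⟩
    suc m ^ 1                       ≡⟨ *-identityʳ (suc m) ⟩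
    suc m                           ≡⟨ sym (+-suc h h) ⟩
    h + suc h                       ∎)
    where
    open ≡-Reasoning
    m : ℕ
    m = h + h

  sufficient : ∀ k n → Condition k n → a k n ∣ n ^ k
  sufficient k .2 (inj₁ refl)                             = subst (_∣ 2 ^ k) (sym (^-zeroˡ k)) (1∣ (2 ^ k))
  sufficient .1 n (inj₂ (inj₁ (refl , divides q refl)))   = subst (λ x → a 1 x ∣ x ^ 1) (sym (q*2≡q+q q)) (a1∣ q)
    where
    q*2≡q+q : ∀ q → q * 2 ≡ q + q
    q*2≡q+q = solve-∀
    a1∣ : ∀ q → a 1 (q + q) ∣ (q + q) ^ 1
    a1∣ zero    = ∣-refl
    a1∣ (suc h) = subst (_∣ (suc h + suc h) ^ 1) (sym (a-one-even h)) (divides 2 (twice h))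
      where
      twice : ∀ h → (suc h + suc h) * 1 ≡ 2 * suc h
      twice = solve-∀
  sufficient .1 .3 (inj₂ (inj₂ (inj₁ refl , refl)))       = 1∣ 3
  sufficient .2 .3 (inj₂ (inj₂ (inj₂ refl , refl)))       = divides 3 refl

  necessary-n=3 : ∀ k → 1 ≤ k → a k 3 ∣ 3 ^ k → Condition k 3
  necessary-n=3 1                 _ _    = inj₂ (inj₂ (inj₁ refl , refl))
  necessary-n=3 2                 _ _    = inj₂ (inj₂ (inj₂ refl , refl))
  necessary-n=3 (suc (suc (suc j))) _ a∣3ᵏ = ⊥-elim (¬∣pow-three j a∣3ᵏ)

  necessary-even : ∀ k c → 1 ≤ k → a k (suc c + suc c) ∣ (suc c + suc c) ^ k → Condition k (suc c + suc c)
  necessary-even k zero    _   _    = inj₁ refl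
  necessary-even k (suc c) 1≤k a∣nᵏ with even-or-odd k | 1≤k
  ... | even zero    | ()
  ... | even (suc g) | _ = ⊥-elim (¬∣pow-even-even g c a∣nᵏ)
  ... | odd zero     | _ = inj₂ (inj₁ (refl , 2∣h+h (suc (suc c))))
  ... | odd (suc g)  | _ = ⊥-elim (¬∣pow-even-odd g c a∣nᵏ)

  necessary-odd : ∀ k h → 1 ≤ k → 1 ≤ h → a k (suc (h + h)) ∣ suc (h + h) ^ k → Condition k (suc (h + h))
  necessary-odd k h 1≤k 1≤h a∣nᵏ with even-or-odd h | 1≤h
  ... | even zero    | ()
  ... | even (suc g) | _ = ⊥-elim (¬∣pow-1mod4 k g 1≤k a∣nᵏ)
  ... | odd zero     | _ = necessary-n=3 k 1≤k a∣nᵏ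
  ... | odd (suc g)  | _ = ⊥-elim (¬∣pow-3mod4 k g a∣nᵏ)

  necessary : ∀ k n → 1 ≤ k → 2 ≤ n → a k n ∣ n ^ k → Condition k n
  necessary k n 1≤k 2≤n a∣nᵏ with even-or-odd n | 2≤n
  ... | even zero    | ()
  ... | even (suc c) | _       = necessary-even k c 1≤k a∣nᵏ
  ... | odd zero     | s≤s ()
  ... | odd (suc h)  | _       = necessary-odd k (suc h) 1≤k (s≤s z≤n) a∣nᵏ

open import Defs
open import Data.Nat using (ℕ; _≤_; _<_)
open import Data.Integer.Divisibility using (_∣_)
open import Data.Nat.Divisibility using () renaming (_∣_ to _∣ℕ_)
open import Data.Product using (_×_)
open import Data.Sum using (_⊎_)
open import Relation.Binary.PropositionalEquality using (_≡_)
open import Function.Bundles using (_⇔_; mk⇔)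
open import Function.Properties.Equivalence using () renaming (trans to ⇔-trans)
open NaturalValues using (A∣A⇔a∣a; ∣next⇔∣pow)
open Classification using (necessary; sufficient)

theorem1 : (k n : ℕ) → 1 ≤ k → 1 < n →
    (A k n ∣ A k (ℕ.suc n)) ⇔
      (n ≡ 2 ⊎ (k ≡ 1 × 2 ∣ℕ n) ⊎ ((k ≡ 1 ⊎ k ≡ 2) × n ≡ 3))
theorem1 k ℕ.zero    _   ()
theorem1 k (ℕ.suc m) 1≤k 1<n =
  ⇔-trans (⇔-trans (A∣A⇔a∣a k (ℕ.suc m)) (∣next⇔∣pow k m))
          (mk⇔ (necessary k (ℕ.suc m) 1≤k 1<n) (sufficient k (ℕ.suc m)))
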